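{- Let $G$ be a graph. Then $G$ is a big-$\mu$ graph if and only if there exists a vertex $v$ of $G$ that is adjacent to every vertex $u$ of $G-v$ satisfying $\deg_{G-v}(u)<n(G)-2$.
   Context: $n(G)$ is the order of $G$, $G-v$ the subgraph induced by $V(G)\setminus\{v\}$, and $\deg_{H}(u)$ the degree of $u$ in $H$. For graphs $A,B$ on disjoint vertex sets, $A\cup B$ is their disjoint union and $A+B$ their join (disjoint union plus all edges between $V(A)$ and $V(B)$). A big-$\mu$ graph is any graph of the form $G=(K_1\cup K_t)+H$, where $K_1$, $K_t$ (a complete graph on $t\ge 0$ vertices, possibly empty) and $H$ (an arbitrary graph) are on pairwise disjoint vertex sets. -}

module Defs where

open import Data.Nat using (ℕ; zero; suc; pred; _+_)
open import Data.Bool using (Bool; true; false; not; if_then_else_)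
open import Data.Fin using (Fin; splitAt; punchIn; _≟_)
open import Data.Fin.Properties using (punchIn-injective)
open import Data.Sum using (_⊎_; inj₁; inj₂)
open import Data.List using (List; length; filterᵇ; allFin)
open import Data.Product using (Σ; ∃; _,_)
open import Relation.Nullary using (yes; no; ¬_)
open import Relation.Nullary.Decidable using (⌊_⌋)
open import Relation.Binary.PropositionalEquality using (_≡_; refl; sym)
open import Function.Bundles using (_↔_; Inverse)

record Graph (n : ℕ) : Set where
  field
    adj    : Fin n → Fin n → Bool
    adj-sym    : ∀ i j → adj i j ≡ adj j i
    adj-irrefl : ∀ i → adj i i ≡ false
open Graph public

order : ∀ {n} → Graph n → ℕ
order {n} _ = n

degree : ∀ {n} → Graph n → Fin n → ℕ
degree {n} G u = length (filterᵇ (adj G u) (allFin n))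

private
  neq : ∀ {t} → Fin t → Fin t → Bool
  neq i j = not ⌊ i ≟ j ⌋

  neq-sym : ∀ {t} (i j : Fin t) → neq i j ≡ neq j i
  neq-sym i j with i ≟ j | j ≟ i
  ... | yes _ | yes _ = refl
  ... | no _  | no _  = refl
  ... | yes p | no q  with q (sym p)
  ... | ()
  neq-sym i j | no q | yes p with q (sym p)
  ... | ()

  neq-irrefl : ∀ {t} (i : Fin t) → neq i i ≡ false
  neq-irrefl i with i ≟ i
  ... | yes _ = refl
  ... | no q with q refl
  ... | ()

K : (t : ℕ) → Graph t
K t = record { adj = neq ; adj-sym = neq-sym ; adj-irrefl = neq-irrefl }

private
  combAdj : ∀ {a b} → Bool → Graph a → Graph b → Fin (a + b) → Fin (a + b) → Bool
  combAdj {a} c A B i j with splitAt a i | splitAt a j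
  ... | inj₁ x | inj₁ y = adj A x y
  ... | inj₂ x | inj₂ y = adj B x y
  ... | inj₁ _ | inj₂ _ = c
  ... | inj₂ _ | inj₁ _ = c

  combSym : ∀ {a b} c (A : Graph a) (B : Graph b) i j → combAdj c A B i j ≡ combAdj c A B j i
  combSym {a} c A B i j with splitAt a i | splitAt a j
  ... | inj₁ x | inj₁ y = adj-sym A x y
  ... | inj₂ x | inj₂ y = adj-sym B x y
  ... | inj₁ _ | inj₂ _ = refl
  ... | inj₂ _ | inj₁ _ = refl

  combIrr : ∀ {a b} c (A : Graph a) (B : Graph b) i → combAdj c A B i i ≡ false
  combIrr {a} c A B i with splitAt a i
  ... | inj₁ x = adj-irrefl A x
  ... | inj₂ x = adj-irrefl B x

  comb : ∀ {a b} → Bool → Graph a → Graph b → Graph (a + b)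
  comb c A B = record { adj = combAdj c A B ; adj-sym = combSym c A B ; adj-irrefl = combIrr c A B }

_∪_ : ∀ {a b} → Graph a → Graph b → Graph (a + b)
A ∪ B = comb false A B

_⊕_ : ∀ {a b} → Graph a → Graph b → Graph (a + b)
A ⊕ B = comb true A B

_≅_ : ∀ {n m} → Graph n → Graph m → Set
_≅_ {n} {m} G H = Σ (Fin n ↔ Fin m) λ f →
  ∀ i j → adj H (Inverse.to f i) (Inverse.to f j) ≡ adj G i j

BigMu : ∀ {n} → Graph n → Set
BigMu G = Σ ℕ λ t → Σ ℕ λ m → Σ (Graph m) λ H → G ≅ ((K 1 ∪ K t) ⊕ H)

-- G - v : induced subgraph on V(G) \ {v} (only meaningful for n ≥ 1, where a vertex v exists);
-- vertex u of G - v is the vertex (inG v u) = punchIn v u of G.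
inG : ∀ {n} → Fin n → Fin (pred n) → Fin n
inG {suc n} v u = punchIn v u

_─_ : ∀ {n} → Graph n → Fin n → Graph (pred n)
_─_ {suc n} G v = record
  { adj = λ i j → adj G (punchIn v i) (punchIn v j)
  ; adj-sym = λ i j → adj-sym G (punchIn v i) (punchIn v j)
  ; adj-irrefl = λ i → adj-irrefl G (punchIn v i) }

-- In G − v a vertex has degree below n(G) − 2 = n(G − v) − 1 exactly when it misses some other
-- vertex of G − v, so the condition on v says: every non-neighbour of v is adjacent to all other
-- vertices of G − v.  For such v the non-neighbours form a clique K_t joined to the graph H induced
-- on the neighbours, and v is the K_1, i.e. G ≅ (K_1 ∪ K_t) + H.  Conversely, in (K_1 ∪ K_t) + H the
-- non-neighbours of the K_1 vertex are the vertices of K_t, which are universal in K_t + H.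
module Submission where

open import Defs
open import Data.Nat using (ℕ; zero; suc; pred; _+_; _<_; _≤_; _∸_; z≤n; s≤s)
open import Data.Nat.Properties using (<-irrefl; m≤n⇒m≤1+n)
open import Data.Bool using (Bool; true; false; if_then_else_)
open import Data.Fin using (Fin; zero; suc; punchIn; punchOut; splitAt; join; _↑ˡ_; _↑ʳ_; _≟_)
open import Data.Fin.Properties using (punchInᵢ≢i; punchIn-punchOut; +↔⊎;
  splitAt-↑ˡ; splitAt-↑ʳ; splitAt⁻¹-↑ˡ; splitAt-join)
open import Data.Fin.Permutation using (insert; remove; insert-punchIn; punchIn-permute)
open import Data.List using (length; filterᵇ; tabulate)
open import Data.Sum using (_⊎_; inj₁; inj₂; [_,_]′)
open import Data.Sum.Algebra using (⊎-cong; ⊎-comm; ⊎-assoc)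
open import Data.Product using (Σ; ∃₂; _,_; proj₁; proj₂)
open import Function using (_∘_; const)
open import Function.Bundles using (_↔_; _⇔_; Inverse; Injection; Equivalence; mk⇔)
open import Function.Construct.Composition using (_↔-∘_)
open import Function.Construct.Identity using (↔-id)
open import Function.Construct.Symmetry using (↔-sym)
open import Function.Properties.Inverse using (↔⇒↣)
open import Relation.Nullary using (yes; no; contradiction)
open import Relation.Binary.PropositionalEquality using (_≡_; _≢_; refl; sym; trans; cong; cong₂; subst; module ≡-Reasoning)

count : ∀ {k} → (Fin k → Bool) → ℕ
count {zero}  p = 0
count {suc k} p = if p zero then suc (count (p ∘ suc)) else count (p ∘ suc)

length-filterᵇ-tabulate : ∀ {A : Set} {k} (p : A → Bool) (f : Fin k → A) →
  length (filterᵇ p (tabulate f)) ≡ count (p ∘ f)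
length-filterᵇ-tabulate {k = zero}  p f = refl
length-filterᵇ-tabulate {k = suc k} p f with p (f zero)
... | true  = cong suc (length-filterᵇ-tabulate p (f ∘ suc))
... | false = length-filterᵇ-tabulate p (f ∘ suc)

count-≤ : ∀ {k} (p : Fin k → Bool) → count p ≤ k
count-≤ {zero}  p = z≤n
count-≤ {suc k} p with p zero
... | true  = s≤s (count-≤ (p ∘ suc))
... | false = m≤n⇒m≤1+n (count-≤ (p ∘ suc))

count-true : ∀ {k} (p : Fin k → Bool) → (∀ i → p i ≡ true) → count p ≡ k
count-true {zero}  p all = refl
count-true {suc k} p all rewrite all zero = cong suc (count-true (p ∘ suc) (all ∘ suc))

count-punchIn : ∀ {k} (p : Fin (suc k) → Bool) i → p i ≡ false → count p ≡ count (p ∘ punchIn i)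
count-punchIn p zero    pi≡false rewrite pi≡false = refl
count-punchIn {suc k} p (suc i) pi≡false with p zero
... | true  = cong suc (count-punchIn (p ∘ suc) i pi≡false)
... | false = count-punchIn (p ∘ suc) i pi≡false

count-< : ∀ {k} (p : Fin k → Bool) i → p i ≡ false → count p < k
count-< {suc k} p i pi≡false rewrite count-punchIn p i pi≡false = s≤s (count-≤ (p ∘ punchIn i))

Universal : ∀ {n} → Graph n → Fin n → Set
Universal G u = ∀ w → w ≢ u → adj G u w ≡ true

degree-count : ∀ {n} (G : Graph n) u → degree G u ≡ count (adj G u)
degree-count G u = length-filterᵇ-tabulate (adj G u) (λ w → w)

universal⇒degree≡ : ∀ {n} (G : Graph n) u → Universal G u → degree G u ≡ n ∸ 1
universal⇒degree≡ {suc n} G u universal = begin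
  degree G u                       ≡⟨ degree-count G u ⟩
  count (adj G u)                  ≡⟨ count-punchIn (adj G u) u (adj-irrefl G u) ⟩
  count (adj G u ∘ punchIn u)      ≡⟨ count-true _ (λ w → universal (punchIn u w) (punchInᵢ≢i u w)) ⟩
  n                                ∎
  where open ≡-Reasoning

nonadjacent⇒degree< : ∀ {n} (G : Graph n) {u w} → w ≢ u → adj G u w ≡ false → degree G u < n ∸ 1
nonadjacent⇒degree< {suc n} G {u} {w} w≢u uw≡false rewrite degree-count G u
                                                          | count-punchIn (adj G u) u (adj-irrefl G u) =
  count-< (adj G u ∘ punchIn u) (punchOut u≢w) (trans (cong (adj G u) (punchIn-punchOut u≢w)) uw≡false)
  where
  u≢w : u ≢ w
  u≢w = w≢u ∘ sym

NonNeighboursUniversal : ∀ {n} → Graph n → Fin n → Set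
NonNeighboursUniversal G v = ∀ u → adj G v (inG v u) ≡ false → Universal (G ─ v) u

deficient-adjacent⇔nonNeighboursUniversal : ∀ {n} (G : Graph n) v →
  (∀ u → degree (G ─ v) u < order G ∸ 2 → adj G v (inG v u) ≡ true) ⇔ NonNeighboursUniversal G v
deficient-adjacent⇔nonNeighboursUniversal {suc n} G v = mk⇔ to from
  where
  to : (∀ u → degree (G ─ v) u < n ∸ 1 → adj G v (inG v u) ≡ true) → NonNeighboursUniversal G v
  to deficient⇒adjacent u vu≡false w w≢u with adj (G ─ v) u w in uw
  ... | true  = refl
  ... | false with trans (sym (deficient⇒adjacent u (nonadjacent⇒degree< (G ─ v) w≢u uw))) vu≡false
  ...   | ()
  from : NonNeighboursUniversal G v → ∀ u → degree (G ─ v) u < n ∸ 1 → adj G v (inG v u) ≡ true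
  from nonNeighboursUniversal u deficient with adj G v (inG v u) in vu
  ... | true  = refl
  ... | false = contradiction deficient
                  (<-irrefl (universal⇒degree≡ (G ─ v) u (nonNeighboursUniversal u vu)))

≅-universal : ∀ {n m} {G : Graph n} {G′ : Graph m} (f : G ≅ G′) {u} →
  Universal G′ (Inverse.to (proj₁ f) u) → Universal G u
≅-universal f {u} universal w w≢u =
  trans (sym (proj₂ f u w)) (universal _ (w≢u ∘ Injection.injective (↔⇒↣ (proj₁ f))))

≅-remove : ∀ {n m} {G : Graph (suc n)} {G′ : Graph (suc m)} (f : G ≅ G′) v →
  (G ─ v) ≅ (G′ ─ Inverse.to (proj₁ f) v)
≅-remove {G = G} {G′} f v = remove v π , λ i j → begin
  adj G′ (punchIn (to v) (to′ i)) (punchIn (to v) (to′ j))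
    ≡⟨ sym (cong₂ (adj G′) (punchIn-permute π v i) (punchIn-permute π v j)) ⟩
  adj G′ (to (punchIn v i)) (to (punchIn v j))
    ≡⟨ proj₂ f (punchIn v i) (punchIn v j) ⟩
  adj G (punchIn v i) (punchIn v j)
    ∎
  where
  open ≡-Reasoning
  π = proj₁ f
  to = Inverse.to π
  to′ = Inverse.to (remove v π)

≅-nonNeighboursUniversal : ∀ {n m} {G : Graph (suc n)} {G′ : Graph (suc m)} (f : G ≅ G′) {v} →
  NonNeighboursUniversal G′ (Inverse.to (proj₁ f) v) → NonNeighboursUniversal G v
≅-nonNeighboursUniversal {G = G} {G′} f {v} nonNeighboursUniversal u vu≡false =
  ≅-universal {G = G ─ v} {G′ = G′ ─ to v} (≅-remove {G = G} {G′ = G′} f v) {u}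
    (nonNeighboursUniversal (to′ u) (begin
      adj G′ (to v) (punchIn (to v) (to′ u)) ≡⟨ cong (adj G′ (to v)) (sym (punchIn-permute (proj₁ f) v u)) ⟩
      adj G′ (to v) (to (punchIn v u))       ≡⟨ proj₂ f v (punchIn v u) ⟩
      adj G v (punchIn v u)                  ≡⟨ vu≡false ⟩
      false                                  ∎))
  where
  open ≡-Reasoning
  to = Inverse.to (proj₁ f)
  to′ = Inverse.to (remove v (proj₁ f))

punchIn-cases : ∀ {n} (v i : Fin (suc n)) → v ≡ i ⊎ Σ (Fin n) λ a → punchIn v a ≡ i
punchIn-cases v i with v ≟ i
... | yes v≡i = inj₁ v≡i
... | no  v≢i = inj₂ (punchOut v≢i , punchIn-punchOut v≢i)

≅-insert : ∀ {n m} (G : Graph (suc n)) (G′ : Graph (suc m)) {v v′} (f : (G ─ v) ≅ (G′ ─ v′)) →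
  (∀ a → adj G′ v′ (punchIn v′ (Inverse.to (proj₁ f) a)) ≡ adj G v (punchIn v a)) → G ≅ G′
≅-insert G G′ {v} {v′} f apex-adj = π , preserves
  where
  π = insert v v′ (proj₁ f)
  to = Inverse.to π

  to-v : to v ≡ v′
  to-v with v ≟ v
  ... | yes _   = refl
  ... | no  v≢v = contradiction refl v≢v

  to-punchIn : ∀ a → to (punchIn v a) ≡ punchIn v′ (Inverse.to (proj₁ f) a)
  to-punchIn = insert-punchIn v v′ (proj₁ f)

  preserves-apex : ∀ a → adj G′ (to v) (to (punchIn v a)) ≡ adj G v (punchIn v a)
  preserves-apex a = trans (cong₂ (adj G′) to-v (to-punchIn a)) (apex-adj a)

  preserves : ∀ i j → adj G′ (to i) (to j) ≡ adj G i j
  preserves i j with punchIn-cases v i | punchIn-cases v j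
  ... | inj₁ refl       | inj₁ refl       = trans (adj-irrefl G′ (to v)) (sym (adj-irrefl G v))
  ... | inj₁ refl       | inj₂ (b , refl) = preserves-apex b
  ... | inj₂ (a , refl) | inj₁ refl       = trans (adj-sym G′ _ _) (trans (preserves-apex a) (adj-sym G _ _))
  ... | inj₂ (a , refl) | inj₂ (b , refl) = trans (cong₂ (adj G′) (to-punchIn a) (to-punchIn b)) (proj₂ f a b)

induced : ∀ {n m} → Graph n → (Fin m → Fin n) → Graph m
induced G f = record
  { adj        = λ i j → adj G (f i) (f j)
  ; adj-sym    = λ i j → adj-sym G (f i) (f j)
  ; adj-irrefl = λ i → adj-irrefl G (f i)
  }

K-universal : ∀ t y → Universal (K t) y
K-universal t y w w≢y with y ≟ w
... | yes y≡w = contradiction (sym y≡w) w≢y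
... | no  _   = refl

⊕-universalˡ : ∀ {a b} (A : Graph a) (B : Graph b) {y} → Universal A y → Universal (A ⊕ B) (y ↑ˡ b)
⊕-universalˡ {a} {b} A B {y} universal w w≢y rewrite splitAt-↑ˡ a y b with splitAt a w in e
... | inj₁ y′ = universal y′ (λ y′≡y → w≢y (trans (sym (splitAt⁻¹-↑ˡ e)) (cong (_↑ˡ b) y′≡y)))
... | inj₂ _  = refl

⊕-adj-↑ʳ : ∀ {a b} (A : Graph a) (B : Graph b) z z′ → adj (A ⊕ B) (a ↑ʳ z) (a ↑ʳ z′) ≡ adj B z z′
⊕-adj-↑ʳ {a} {b} A B z z′ rewrite splitAt-↑ʳ a b z | splitAt-↑ʳ a b z′ = refl

isInj₂ᵇ : ∀ {A B : Set} → A ⊎ B → Bool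
isInj₂ᵇ = [ const false , const true ]′

isInj₂ᵇ-true : ∀ {A B : Set} (s : A ⊎ B) → isInj₂ᵇ s ≡ true → Σ B λ z → s ≡ inj₂ z
isInj₂ᵇ-true (inj₂ z) _ = z , refl

K⊕-universal : ∀ t {m} (H : Graph m) x → isInj₂ᵇ (splitAt t x) ≡ false → Universal (K t ⊕ H) x
K⊕-universal t H x = universal (splitAt t x) refl
  where
  universal : ∀ s → splitAt t x ≡ s → isInj₂ᵇ s ≡ false → Universal (K t ⊕ H) x
  universal (inj₁ y) e _ =
    subst (Universal (K t ⊕ H)) (splitAt⁻¹-↑ˡ e) (⊕-universalˡ (K t) H (K-universal t y))
  universal (inj₂ _) _ ()

≅-K⊕-induced : ∀ {n t m} (G : Graph n) (σ : Fin n ↔ (Fin t ⊎ Fin m)) →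
  (∀ a b → a ≢ b → isInj₂ᵇ (Inverse.to σ a) ≡ false → adj G a b ≡ true) →
  G ≅ (K t ⊕ induced G (Inverse.from σ ∘ inj₂))
≅-K⊕-induced {t = t} {m} G σ left-universal = τ , preserves
  where
  H = induced G (Inverse.from σ ∘ inj₂)
  τ = ↔-sym (+↔⊎ {t} {m}) ↔-∘ σ

  isInj₂ᵇ-τ : ∀ a → isInj₂ᵇ (splitAt t (Inverse.to τ a)) ≡ isInj₂ᵇ (Inverse.to σ a)
  isInj₂ᵇ-τ a = cong isInj₂ᵇ (splitAt-join t m (Inverse.to σ a))

  both-left-universal : ∀ a b → a ≢ b → isInj₂ᵇ (Inverse.to σ a) ≡ false →
    adj (K t ⊕ H) (Inverse.to τ a) (Inverse.to τ b) ≡ adj G a b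
  both-left-universal a b a≢b σa-left = trans
    (K⊕-universal t H _ (trans (isInj₂ᵇ-τ a) σa-left) _ (a≢b ∘ sym ∘ Injection.injective (↔⇒↣ τ)))
    (sym (left-universal a b a≢b σa-left))

  preserves : ∀ a b → adj (K t ⊕ H) (Inverse.to τ a) (Inverse.to τ b) ≡ adj G a b
  preserves a b with a ≟ b | isInj₂ᵇ (Inverse.to σ a) in σa | isInj₂ᵇ (Inverse.to σ b) in σb
  ... | yes refl | _     | _     = trans (adj-irrefl (K t ⊕ H) _) (sym (adj-irrefl G a))
  ... | no  a≢b  | false | _     = both-left-universal a b a≢b σa
  ... | no  a≢b  | true  | false = trans (adj-sym (K t ⊕ H) _ _)
                                     (trans (both-left-universal b a (a≢b ∘ sym) σb) (adj-sym G b a))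
  ... | no  a≢b  | true  | true
    with z , σa≡z ← isInj₂ᵇ-true (Inverse.to σ a) σa
       | z′ , σb≡z′ ← isInj₂ᵇ-true (Inverse.to σ b) σb = begin
    adj (K t ⊕ H) (join t m (Inverse.to σ a)) (join t m (Inverse.to σ b))
      ≡⟨ cong₂ (λ s s′ → adj (K t ⊕ H) (join t m s) (join t m s′)) σa≡z σb≡z′ ⟩
    adj (K t ⊕ H) (t ↑ʳ z) (t ↑ʳ z′)
      ≡⟨ ⊕-adj-↑ʳ (K t) H z z′ ⟩
    adj G (Inverse.from σ (inj₂ z)) (Inverse.from σ (inj₂ z′))
      ≡⟨ cong₂ (adj G) (Inverse.inverseʳ σ (sym σa≡z)) (Inverse.inverseʳ σ (sym σb≡z′)) ⟩
    adj G a b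
      ∎
    where open ≡-Reasoning

consˡ : ∀ {k t} {B : Set} → Fin k ↔ (Fin t ⊎ B) → Fin (suc k) ↔ (Fin (suc t) ⊎ B)
consˡ {t = t} {B} σ =
  ⊎-cong (↔-sym (+↔⊎ {1} {t})) (↔-id _) ↔-∘
  (↔-sym (⊎-assoc _ (Fin 1) (Fin t) B) ↔-∘
  (⊎-cong (↔-id _) σ ↔-∘
  +↔⊎ {1}))

consʳ : ∀ {k m} {A : Set} → Fin k ↔ (A ⊎ Fin m) → Fin (suc k) ↔ (A ⊎ Fin (suc m))
consʳ σ = ⊎-comm _ _ ↔-∘ consˡ (⊎-comm _ _ ↔-∘ σ)

isInj₂ᵇ-consˡ : ∀ {k t} {B : Set} (σ : Fin k ↔ (Fin t ⊎ B)) a →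
  isInj₂ᵇ (Inverse.to (consˡ σ) (suc a)) ≡ isInj₂ᵇ (Inverse.to σ a)
isInj₂ᵇ-consˡ σ a with Inverse.to σ a
... | inj₁ _ = refl
... | inj₂ _ = refl

isInj₂ᵇ-consʳ : ∀ {k m} {A : Set} (σ : Fin k ↔ (A ⊎ Fin m)) a →
  isInj₂ᵇ (Inverse.to (consʳ σ) (suc a)) ≡ isInj₂ᵇ (Inverse.to σ a)
isInj₂ᵇ-consʳ σ a with Inverse.to σ a
... | inj₁ _ = refl
... | inj₂ _ = refl

partition : ∀ {k} (p : Fin k → Bool) →
  ∃₂ λ t m → Σ (Fin k ↔ (Fin t ⊎ Fin m)) λ σ → ∀ a → isInj₂ᵇ (Inverse.to σ a) ≡ p a
partition {zero} p = 0 , 0 , +↔⊎ {0} , λ ()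
partition {suc k} p with partition (p ∘ suc) | p zero in p0
... | t , m , σ , σ-spec | false = suc t , m , consˡ σ , λ where
  zero    → sym p0
  (suc a) → trans (isInj₂ᵇ-consˡ σ a) (σ-spec a)
... | t , m , σ , σ-spec | true = t , suc m , consʳ σ , λ where
  zero    → sym p0
  (suc a) → trans (isInj₂ᵇ-consʳ σ a) (σ-spec a)

BigMuGraph : ∀ t {m} → Graph m → Graph (suc (t + m))
BigMuGraph t H = (K 1 ∪ K t) ⊕ H

BigMuGraph-adj-apex : ∀ t {m} (H : Graph m) x → adj (BigMuGraph t H) zero (suc x) ≡ isInj₂ᵇ (splitAt t x)
BigMuGraph-adj-apex t H x with splitAt t x
... | inj₁ _ = refl
... | inj₂ _ = refl

BigMuGraph-remove-apex : ∀ t {m} (H : Graph m) x x′ → adj (BigMuGraph t H ─ zero) x x′ ≡ adj (K t ⊕ H) x x′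
BigMuGraph-remove-apex t H x x′ with splitAt t x | splitAt t x′
... | inj₁ _ | inj₁ _ = refl
... | inj₁ _ | inj₂ _ = refl
... | inj₂ _ | inj₁ _ = refl
... | inj₂ _ | inj₂ _ = refl

BigMuGraph-nonNeighboursUniversal : ∀ t {m} (H : Graph m) → NonNeighboursUniversal (BigMuGraph t H) zero
BigMuGraph-nonNeighboursUniversal t H x apex-x≡false w w≢x =
  trans (BigMuGraph-remove-apex t H x w)
        (K⊕-universal t H x (trans (sym (BigMuGraph-adj-apex t H x)) apex-x≡false) w w≢x)

bigMu⇒nonNeighboursUniversal : ∀ {n} (G : Graph n) → BigMu G → Σ (Fin n) (NonNeighboursUniversal G)
bigMu⇒nonNeighboursUniversal {zero} G (t , m , H , f) with Inverse.from (proj₁ f) zero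
... | ()
bigMu⇒nonNeighboursUniversal {suc n} G (t , m , H , f) =
  apex , ≅-nonNeighboursUniversal {G = G} {G′ = BigMuGraph t H} f
           (subst (NonNeighboursUniversal (BigMuGraph t H)) (sym (Inverse.strictlyInverseˡ (proj₁ f) zero))
                  (BigMuGraph-nonNeighboursUniversal t H))
  where
  apex = Inverse.from (proj₁ f) zero

nonNeighboursUniversal⇒bigMu : ∀ {n} (G : Graph n) v → NonNeighboursUniversal G v → BigMu G
nonNeighboursUniversal⇒bigMu {suc n} G v nonNeighboursUniversal with partition (adj G v ∘ punchIn v)
... | t , m , σ , σ-spec = t , m , H , ≅-insert G (BigMuGraph t H) {v} {zero} f apex-adj
  where
  H = induced (G ─ v) (Inverse.from σ ∘ inj₂)

  f₀ : (G ─ v) ≅ (K t ⊕ H)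
  f₀ = ≅-K⊕-induced (G ─ v) σ λ a b a≢b σa-left →
         nonNeighboursUniversal a (trans (sym (σ-spec a)) σa-left) b (a≢b ∘ sym)

  f : (G ─ v) ≅ (BigMuGraph t H ─ zero)
  f = proj₁ f₀ , λ a b → trans (BigMuGraph-remove-apex t H _ _) (proj₂ f₀ a b)

  apex-adj : ∀ a → adj (BigMuGraph t H) zero (suc (Inverse.to (proj₁ f) a)) ≡ adj G v (punchIn v a)
  apex-adj a = begin
    adj (BigMuGraph t H) zero (suc (join t m (Inverse.to σ a))) ≡⟨ BigMuGraph-adj-apex t H _ ⟩
    isInj₂ᵇ (splitAt t (join t m (Inverse.to σ a)))             ≡⟨ cong isInj₂ᵇ (splitAt-join t m (Inverse.to σ a)) ⟩
    isInj₂ᵇ (Inverse.to σ a)                                    ≡⟨ σ-spec a ⟩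
    adj G v (punchIn v a)                                       ∎
    where open ≡-Reasoning

lemma4p4 : ∀ {n} (G : Graph n) →
    BigMu G ⇔
      (Σ (Fin n) λ v →
        ∀ (u : Fin (pred n)) → degree (G ─ v) u < order G ∸ 2 →
          adj G v (inG v u) ≡ true)
lemma4p4 G = mk⇔
  (λ bigMu → let v , nonNeighboursUniversal = bigMu⇒nonNeighboursUniversal G bigMu in
     v , from (deficient-adjacent⇔nonNeighboursUniversal G v) nonNeighboursUniversal)
  (λ (v , deficient-adjacent) →
     nonNeighboursUniversal⇒bigMu G v (to (deficient-adjacent⇔nonNeighboursUniversal G v) deficient-adjacent))
  where open Equivalence
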